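{- Let $K$ be a field, $E=K\langle e_1,\dots,e_n\rangle$ the exterior algebra, $M\in\mathcal{M}$, and let $v_1,\dots,v_s\in E_1$ be an $M^*$-regular sequence. Then $$(M/(v_1,\dots,v_s)M)^*\cong v_1\cdots v_s M^*$$ as graded $E$-modules.
   Context: $E$ is standard graded with $\deg e_i=1$. $\mathcal{M}$ is the category of finitely generated graded left and right $E$-modules $M$ with $am=(-1)^{\deg a\deg m}ma$ for homogeneous $a,m$. $N^*=\operatorname{Hom}_E(N,E)$ denotes the dual. An element $v\in E_1$ is $N$-regular if $0:_Nv=vN$; a sequence $v_1,\dots,v_s\in E_1$ is $N$-regular if $v_i$ is $N/(v_1,\dots,v_{i-1})N$-regular for each $i$ and $N/(v_1,\dots,v_s)N\neq0$. -}

module Defs where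

open import Level using (Level; _⊔_; Lift) renaming (suc to lsuc)
open import Data.Nat as ℕ using (ℕ; zero; suc; _<ᵇ_)
open import Data.Integer as ℤ using (ℤ; +_)
open import Data.Bool using (Bool; true; false; if_then_else_)
open import Data.Fin as Fin using (Fin; toℕ)
open import Data.Fin.Subset using (Subset; ∣_∣; _∩_; _─_; ⁅_⁆)
open import Data.Vec using (lookup; tabulate)
open import Data.Product using (Σ; ∃; _×_)
open import Data.Unit.Polymorphic using (⊤)
open import Relation.Nullary using (¬_)
open import Relation.Binary.PropositionalEquality using (_≡_; subst)
open import Algebra.Bundles using (CommutativeRing)
open import Algebra.Module.Bundles using (Module)

record Field (c ℓ : Level) : Set (lsuc (c ⊔ ℓ)) where
  field
    commutativeRing : CommutativeRing c ℓ
  open CommutativeRing commutativeRing public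
  field
    0≉1 : ¬ (0# ≈ 1#)
    inverse : ∀ x → ¬ (x ≈ 0#) → Σ Carrier λ y → x * y ≈ 1#

sucⁿ : ℕ → ℤ → ℤ
sucⁿ zero    d = d
sucⁿ (suc k) d = ℤ.suc (sucⁿ k d)

module Exterior {c ℓ : Level} (K : Field c ℓ) (n : ℕ) where
  open Field K renaming (Carrier to Kc; _≈_ to _≈K_)

  negPow : ℕ → Kc → Kc
  negPow zero    x = x
  negPow (suc k) x = - negPow k x

  -- (-1)^j * x for an integer j (only the parity of j matters)
  sgn : ℤ → Kc → Kc
  sgn j x = negPow ℤ.∣ j ∣ x

  -- Elements of E: coefficient functions on the monomial basis
  -- e_S = e_{s₁} ∧ ⋯ ∧ e_{s_k}  (s₁ < ⋯ < s_k),  S ⊆ {1,…,n}.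
  Ext : Set c
  Ext = Subset n → Kc

  _≈E_ : Ext → Ext → Set ℓ
  f ≈E g = ∀ S → f S ≈K g S

  _+E_ : Ext → Ext → Ext
  (f +E g) S = f S + g S

  _·E_ : Kc → Ext → Ext
  (a ·E f) S = a * f S

  0E : Ext
  0E S = 0#

  Homog : ℤ → Ext → Set ℓ
  Homog d f = ∀ S → ¬ (+ ∣ S ∣ ≡ d) → f S ≈K 0#

  below : Fin n → Subset n
  below i = tabulate (λ k → toℕ k <ᵇ toℕ i)

  -- left multiplication by the generator e_i:
  -- e_i ∧ e_S = (-1)^{#{k ∈ S | k < i}} e_{S ∪ {i}} if i ∉ S, and 0 otherwise
  eMul : Fin n → Ext → Ext
  eMul i f T = if lookup T i
               then negPow ∣ T ∩ below i ∣ (f (T ─ ⁅ i ⁆))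
               else 0#

  -- degree-one elements of E: v = Σ_i v_i e_i
  E₁ : Set c
  E₁ = Fin n → Kc

  -- Raw graded data: a ℤ-graded family of carriers with K-vector space
  -- operations, the action of the generators e_i (raising degree by 1),
  -- and a predicate In singling out the admissible elements
  -- (used for Hom-sets and submodules).

  record GData (a p : Level) : Set (lsuc (a ⊔ p) ⊔ c) where
    field
      C    : ℤ → Set a
      _≈_  : ∀ {d} → C d → C d → Set p
      _+g_ : ∀ {d} → C d → C d → C d
      _·g_ : ∀ {d} → Kc → C d → C d
      0g   : ∀ {d} → C d
      act  : Fin n → ∀ d → C d → C (ℤ.suc d)
      In   : ∀ d → C d → Set p

  module _ {a p : Level} (N : GData a p) where
    open GData N

    _−g_ : ∀ {d} → C d → C d → C d
    x −g y = x +g ((- 1#) ·g y)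

    sumFin : ∀ {d k} → (Fin k → C d) → C d
    sumFin {k = zero}  z = 0g
    sumFin {k = suc k} z = z Fin.zero +g sumFin (λ t → z (Fin.suc t))

    actV : E₁ → ∀ d → C d → C (ℤ.suc d)
    actV v d x = sumFin (λ i → v i ·g act i d x)

    actProd : ∀ {k} → (Fin k → E₁) → ∀ d → C d → C (sucⁿ k d)
    actProd {zero}  vs d x = x
    actProd {suc k} vs d x =
      actV (vs Fin.zero) (sucⁿ k d) (actProd (λ t → vs (Fin.suc t)) d x)

    -- the quotient N / (u₁,…,u_k) N  (same carriers, coarser equality)
    quot : ∀ {k} → (Fin k → E₁) → GData a (a ⊔ p)
    quot {k} us = record
      { C = C ; _+g_ = _+g_ ; _·g_ = _·g_ ; 0g = 0g ; act = act ; In = λ d x → Lift a (In d x)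
      ; _≈_ = λ {d} x y →
          Σ ℤ λ d' → Σ (ℤ.suc d' ≡ d) λ eq →
          Σ (Fin k → C d') λ z →
            (∀ t → In d' (z t)) ×
            ((x −g y) ≈ subst C eq (sumFin (λ t → actV (us t) d' (z t))))
      }

    -- v ∈ E₁ is N-regular:  0 :_N v = v N
    Regular : E₁ → Set (a ⊔ p)
    Regular v = ∀ d (x : C d) → In d x →
      ((actV v d x ≈ 0g) →
         Σ ℤ λ d' → Σ (ℤ.suc d' ≡ d) λ eq → Σ (C d') λ y →
           In d' y × (x ≈ subst C eq (actV v d' y)))
      × ((Σ ℤ λ d' → Σ (ℤ.suc d' ≡ d) λ eq → Σ (C d') λ y →
           In d' y × (x ≈ subst C eq (actV v d' y)))
         → actV v d x ≈ 0g)

    NonZero : Set (a ⊔ p)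
    NonZero = Σ ℤ λ d → Σ (C d) λ x → In d x × ¬ (x ≈ 0g)

    image : ∀ {k} → (Fin k → E₁) → GData a (a ⊔ p)
    image {k} us = record
      { C = C ; _≈_ = λ x y → Lift a (x ≈ y) ; _+g_ = _+g_ ; _·g_ = _·g_ ; 0g = 0g ; act = act
      ; In = λ d x → In d x ×
          (Σ ℤ λ d' → Σ (sucⁿ k d' ≡ d) λ eq → Σ (C d') λ y →
             In d' y × (x ≈ subst C eq (actProd us d' y)))
      }

    -- homogeneous E-homomorphisms N → E of degree j, in the convention of
    -- the category 𝓜 (right E-linear: φ(m a) = φ(m) a, which for the left
    -- action means φ(e_i m) = (-1)^j e_i φ(m)).
    record IsHom (j : ℤ) (φ : (d : ℤ) → C d → Ext) : Set (a ⊔ p ⊔ ℓ ⊔ c) where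
      field
        cong  : ∀ d x y → In d x → In d y → x ≈ y → φ d x ≈E φ d y
        hom-+ : ∀ d x y → In d x → In d y → φ d (x +g y) ≈E (φ d x +E φ d y)
        hom-· : ∀ d r x → In d x → φ d (r ·g x) ≈E (r ·E φ d x)
        homog : ∀ d x → In d x → Homog (d ℤ.+ j) (φ d x)
        hom-e : ∀ i d x → In d x →
                φ (ℤ.suc d) (act i d x) ≈E (λ S → sgn j (eMul i (φ d x) S))

    dual : GData (a ⊔ c) (a ⊔ p ⊔ ℓ ⊔ c)
    dual = record
      { C   = λ j → (d : ℤ) → C d → Ext
      ; _≈_ = λ φ ψ → Lift c (∀ d x → In d x → φ d x ≈E ψ d x)
      ; _+g_ = λ φ ψ d x → φ d x +E ψ d x
      ; _·g_ = λ r φ d x → r ·E φ d x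
      ; 0g  = λ d x → 0E
      ; act = λ i j φ d x → eMul i (φ d x)
      ; In  = λ j φ → IsHom j φ
      }

  RegularSeq : ∀ {a p s} → GData a p → (Fin s → E₁) → Set (a ⊔ p)
  RegularSeq N vs =
    (∀ i → Regular (quot N (λ (t : Fin.Fin′ i) → vs (Fin.inject t))) (vs i))
    × NonZero (quot N vs)

  record _≅_ {a p a' p'} (A : GData a p) (B : GData a' p')
         : Set (a ⊔ p ⊔ a' ⊔ p' ⊔ c) where
    private
      module A = GData A
      module B = GData B
    field
      to     : ∀ d → A.C d → B.C d
      from   : ∀ d → B.C d → A.C d
      to-In  : ∀ d x → A.In d x → B.In d (to d x)
      from-In : ∀ d y → B.In d y → A.In d (from d y)
      to-cong : ∀ d x y → A.In d x → A.In d y → A._≈_ x y → B._≈_ (to d x) (to d y)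
      from-cong : ∀ d x y → B.In d x → B.In d y → B._≈_ x y → A._≈_ (from d x) (from d y)
      to-from : ∀ d y → B.In d y → B._≈_ (to d (from d y)) y
      from-to : ∀ d x → A.In d x → A._≈_ (from d (to d x)) x
      to-+   : ∀ d x y → A.In d x → A.In d y →
               B._≈_ (to d (A._+g_ x y)) (B._+g_ (to d x) (to d y))
      to-·   : ∀ d r x → A.In d x → B._≈_ (to d (A._·g_ r x)) (B._·g_ r (to d x))
      to-act : ∀ i d x → A.In d x →
               B._≈_ (to (ℤ.suc d) (A.act i d x)) (B.act i d (to d x))

  -- A graded left
  -- E-module is a ℤ-graded K-vector space with degree-one K-linear maps
  -- e_i satisfying e_i e_i = 0 and e_i e_j = - e_j e_i (the defining
  -- relations of E); the right structure is determined by
  -- m a = (-1)^{deg a deg m} a m.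

  record GradedModule (m ℓm : Level) : Set (c ⊔ ℓ ⊔ lsuc (m ⊔ ℓm)) where
    field
      Mod : ℤ → Module commutativeRing m ℓm
    module Mod (d : ℤ) = Module (Mod d)
    field
      act      : Fin n → ∀ d → Mod.Carrierᴹ d → Mod.Carrierᴹ (ℤ.suc d)
      act-cong : ∀ i d {x y} → Mod._≈ᴹ_ d x y →
                 Mod._≈ᴹ_ (ℤ.suc d) (act i d x) (act i d y)
      act-+    : ∀ i d x y → Mod._≈ᴹ_ (ℤ.suc d)
                   (act i d (Mod._+ᴹ_ d x y))
                   (Mod._+ᴹ_ (ℤ.suc d) (act i d x) (act i d y))
      act-·    : ∀ i d r x → Mod._≈ᴹ_ (ℤ.suc d)
                   (act i d (Mod._*ₗ_ d r x)) (Mod._*ₗ_ (ℤ.suc d) r (act i d x))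
      act-sq   : ∀ i d x → Mod._≈ᴹ_ (ℤ.suc (ℤ.suc d))
                   (act i (ℤ.suc d) (act i d x)) (Mod.0ᴹ (ℤ.suc (ℤ.suc d)))
      act-anti : ∀ i j d x → Mod._≈ᴹ_ (ℤ.suc (ℤ.suc d))
                   (act i (ℤ.suc d) (act j d x))
                   (Mod.-ᴹ_ (ℤ.suc (ℤ.suc d)) (act j (ℤ.suc d) (act i d x)))

    data′ : GData m ℓm
    data′ = record
      { C = Mod.Carrierᴹ ; _≈_ = λ {d} → Mod._≈ᴹ_ d ; _+g_ = λ {d} → Mod._+ᴹ_ d
      ; _·g_ = λ {d} → Mod._*ₗ_ d ; 0g = λ {d} → Mod.0ᴹ d ; act = act
      ; In = λ _ _ → ⊤ }

    data Span {k : ℕ} (deg : Fin k → ℤ) (g : (t : Fin k) → Mod.Carrierᴹ (deg t))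
              : (d : ℤ) → Mod.Carrierᴹ d → Set (c ⊔ m ⊔ ℓm) where
      gen  : ∀ t {x} → Mod._≈ᴹ_ (deg t) x (g t) → Span deg g (deg t) x
      zer  : ∀ d {x} → Mod._≈ᴹ_ d x (Mod.0ᴹ d) → Span deg g d x
      plus : ∀ d {x y z} → Span deg g d y → Span deg g d z →
             Mod._≈ᴹ_ d x (Mod._+ᴹ_ d y z) → Span deg g d x
      scal : ∀ d r {x y} → Span deg g d y →
             Mod._≈ᴹ_ d x (Mod._*ₗ_ d r y) → Span deg g d x
      mul  : ∀ i d {x y} → Span deg g d y →
             Mod._≈ᴹ_ (ℤ.suc d) x (act i d y) → Span deg g (ℤ.suc d) x

    FinitelyGenerated : Set (c ⊔ m ⊔ ℓm)
    FinitelyGenerated =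
      Σ ℕ λ k → Σ (Fin k → ℤ) λ deg → Σ ((t : Fin k) → Mod.Carrierᴹ (deg t)) λ g →
        ∀ d x → Span deg g d x

module Submission where

-- A homomorphism φ : M → E of degree j factors through M/(v₁,…,v_s)M iff it kills every
-- v_t M, and since φ(v m) = ±v φ(m) this says that v_t φ = 0 in M*.  So (M/vM)* is, inside
-- M*, the common annihilator of the v_t, and the isomorphism is the identity on maps.  The
-- submodule v₁⋯v_s M* lies in that annihilator because elements of E₁ anticommute and square
-- to zero.  Conversely, by induction on k: if v₁⋯v_k φ = 0 then φ ∈ (v₁,…,v_k)M*, by
-- regularity of v_k modulo (v₁,…,v_{k-1})M*; and if v₁,…,v_k all kill φ, write
-- φ = v₁⋯v_{k-1}ψ, note v₁⋯v_{k-1}(v_k ψ) = ±v_k φ = 0, so v_k ψ ∈ (v₁,…,v_{k-1})M*, hence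
-- ψ ≡ v_k η modulo that ideal, which v₁⋯v_{k-1} kills: φ = v₁⋯v_k η.

open import Defs
open import Level using (_⊔_; lift; lower)
open import Data.Nat as ℕ using (ℕ; zero; suc)
import Data.Nat.Properties as ℕ
open import Data.Integer as ℤ using (ℤ)
import Data.Integer.Properties as ℤ
open import Data.Fin as Fin using (Fin; zero; suc; toℕ)
import Data.Fin.Properties as Fin
open import Data.Bool using (Bool; true; false; if_then_else_)
open import Data.Vec as Vec using (_∷_; lookup)
open import Data.Fin.Subset as Sub using (Subset; ∣_∣; _∩_; _─_; ⁅_⁆)
open import Data.Fin.Subset.Properties using (∩-zeroʳ; ∣⊥∣≡0; p─⊥≡p)
open import Data.Product using (Σ; _×_; _,_; proj₁)
open import Function using (_∘_)
open import Relation.Binary.PropositionalEquality as ≡ using (_≡_)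

∣p∣≡suc∣p-x∣ : ∀ {m} (p : Subset m) (x : Fin m) → lookup p x ≡ true → ∣ p ∣ ≡ suc ∣ p ─ ⁅ x ⁆ ∣
∣p∣≡suc∣p-x∣ (true  ∷ p) zero    _   = ≡.cong (suc ∘ ∣_∣) (≡.sym (p─⊥≡p p))
∣p∣≡suc∣p-x∣ (false ∷ p) (suc x) x∈p = ∣p∣≡suc∣p-x∣ p x x∈p
∣p∣≡suc∣p-x∣ (true  ∷ p) (suc x) x∈p = ≡.cong suc (∣p∣≡suc∣p-x∣ p x x∈p)

module Scalars {c ℓ} (K : Field c ℓ) where
  open Field K
  open import Algebra.Properties.Ring ring public
  open import Algebra.Properties.CommutativeSemigroup +-commutativeSemigroup public using (interchange)
  open import Algebra.Properties.CommutativeSemigroup *-commutativeSemigroup public using (x∙yz≈y∙xz)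
  open import Algebra.Properties.Semiring.Sum semiring public
  open import Algebra.Solver.CommutativeMonoid +-commutativeMonoid using (solve; _⊜_; _⊕_)
  open import Relation.Binary.Reasoning.Setoid setoid

  x-[x-y]≈y : ∀ x y → x - (x - y) ≈ y
  x-[x-y]≈y x y = begin
    x - (x - y)      ≈⟨ +-congˡ (-‿anti-homo-+ x (- y)) ⟩
    x + (- - y - x)  ≈⟨ +-congˡ (+-comm (- - y) (- x)) ⟩
    x + (- x + - - y) ≈⟨ +-assoc x (- x) (- - y) ⟨
    (x - x) + - - y  ≈⟨ +-cong (-‿inverseʳ x) (-‿involutive y) ⟩
    0# + y           ≈⟨ +-identityˡ y ⟩
    y                ∎

  [x-[y-z]]+[y-[x-w]]≈z+w : ∀ x y z w → (x - (y - z)) + (y - (x - w)) ≈ z + w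
  [x-[y-z]]+[y-[x-w]]≈z+w x y z w = begin
    (x - (y - z)) + (y - (x - w))
      ≈⟨ +-cong (+-congˡ (-‿anti-homo-+ y (- z))) (+-congˡ (-‿anti-homo-+ x (- w))) ⟩
    (x + (- - z - y)) + (y + (- - w - x))
      ≈⟨ solve 6 (λ x y z w x′ y′ →
                    (x ⊕ (z ⊕ y′)) ⊕ (y ⊕ (w ⊕ x′)) ⊜ (x ⊕ x′) ⊕ ((y ⊕ y′) ⊕ (z ⊕ w)))
           refl x y (- - z) (- - w) (- x) (- y) ⟩
    (x - x) + ((y - y) + (- - z + - - w))
      ≈⟨ +-cong (-‿inverseʳ x) (+-cong (-‿inverseʳ y) (+-cong (-‿involutive z) (-‿involutive w))) ⟩
    0# + (0# + (z + w)) ≈⟨ trans (+-identityˡ _) (+-identityˡ _) ⟩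
    z + w ∎

  [x+-1*y]+y≈x : ∀ x y → (x + - 1# * y) + y ≈ x
  [x+-1*y]+y≈x x y = begin
    (x + - 1# * y) + y ≈⟨ +-assoc x (- 1# * y) y ⟩
    x + (- 1# * y + y) ≈⟨ +-congˡ (+-congʳ (-1*x≈-x y)) ⟩
    x + (- y + y)      ≈⟨ +-congˡ (-‿inverseˡ y) ⟩
    x + 0#             ≈⟨ +-identityʳ x ⟩
    x                  ∎

  sum-+ : ∀ {k} (f g : Fin k → Carrier) → sum (λ i → f i + g i) ≈ sum f + sum g
  sum-+ {zero}  f g = sym (+-identityʳ 0#)
  sum-+ {suc k} f g = trans (+-congˡ (sum-+ (f ∘ suc) (g ∘ suc))) (interchange _ _ _ _)

  sum-neg : ∀ {k} (f : Fin k → Carrier) → sum (λ i → - f i) ≈ - sum f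
  sum-neg f = trans (sum-cong-≋ (λ i → sym (-1*x≈-x (f i))))
                (trans (sym (*-distribˡ-sum (- 1#) f)) (-1*x≈-x (sum f)))

  sum-zero : ∀ {k} (f : Fin k → Carrier) → (∀ i → f i ≈ 0#) → sum f ≈ 0#
  sum-zero {k} f f≈0 = trans (sum-cong-≋ f≈0) (sum-replicate-zero k)

  δ : ∀ {k} → Fin k → Fin k → Carrier
  δ zero    zero    = 1#
  δ zero    (suc _) = 0#
  δ (suc _) zero    = 0#
  δ (suc i) (suc j) = δ i j

  sum-δ : ∀ {k} (i : Fin k) (f : Fin k → Carrier) → sum (λ j → δ i j * f j) ≈ f i
  sum-δ zero    f = trans (+-cong (*-identityˡ _) (sum-zero _ (λ j → zeroˡ (f (suc j))))) (+-identityʳ _)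
  sum-δ (suc i) f = trans (+-cong (zeroˡ _) (sum-δ i (f ∘ suc))) (+-identityˡ _)

module Signs {c ℓ} (K : Field c ℓ) (n : ℕ) where
  open Field K
  open Scalars K
  open Exterior K n using (negPow; sgn)
  open import Data.Integer using (+_; -[1+_])

  negPow-cong : ∀ k {x y} → x ≈ y → negPow k x ≈ negPow k y
  negPow-cong zero    x≈y = x≈y
  negPow-cong (suc k) x≈y = -‿cong (negPow-cong k x≈y)

  negPow-+ : ∀ k x y → negPow k (x + y) ≈ negPow k x + negPow k y
  negPow-+ zero    x y = refl
  negPow-+ (suc k) x y = trans (-‿cong (negPow-+ k x y)) (sym (-‿+-comm _ _))

  negPow-* : ∀ k r x → negPow k (r * x) ≈ r * negPow k x
  negPow-* zero    r x = refl
  negPow-* (suc k) r x = trans (-‿cong (negPow-* k r x)) (-‿distribʳ-* r _)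

  negPow-neg : ∀ k x → negPow k (- x) ≈ - negPow k x
  negPow-neg zero    x = refl
  negPow-neg (suc k) x = -‿cong (negPow-neg k x)

  negPow-involutive : ∀ k x → negPow k (negPow k x) ≈ x
  negPow-involutive zero    x = refl
  negPow-involutive (suc k) x =
    trans (-‿cong (negPow-neg k _)) (trans (-‿involutive _) (negPow-involutive k x))

  negPow-zero : ∀ k {x} → x ≈ 0# → negPow k x ≈ 0#
  negPow-zero zero    x≈0 = x≈0
  negPow-zero (suc k) x≈0 = trans (-‿cong (negPow-zero k x≈0)) -0#≈0#

  negPow≈0⇒≈0 : ∀ k {x} → negPow k x ≈ 0# → x ≈ 0#
  negPow≈0⇒≈0 k {x} e = trans (sym (negPow-involutive k x)) (negPow-zero k e)

  negPow-sum : ∀ k {m} (f : Fin m → Carrier) → sum (λ i → negPow k (f i)) ≈ negPow k (sum f)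
  negPow-sum zero    f = refl
  negPow-sum (suc k) f = trans (sum-neg (λ i → negPow k (f i))) (-‿cong (negPow-sum k f))

  sgn-suc : ∀ j x → sgn (ℤ.suc j) x ≈ - sgn j x
  sgn-suc (+ k)            x = refl
  sgn-suc -[1+ zero ]      x = sym (-‿involutive x)
  sgn-suc -[1+ suc k ]     x = sym (-‿involutive _)

  -- negPow only nominally depends on the ambient number of generators.
  negPow-indep : ∀ m k x → negPow k x ≡ Exterior.negPow K m k x
  negPow-indep m zero    x = ≡.refl
  negPow-indep m (suc k) x = ≡.cong -_ (negPow-indep m k x)

module LinearMaps {c ℓ} (K : Field c ℓ) (n : ℕ) where
  open Field K hiding (zero)
  open Scalars K
  open Signs K n
  open Exterior K n

  -E_ : Ext → Ext
  (-E f) S = - f S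

  record IsLinear (L : Ext → Ext) : Set (c ⊔ ℓ) where
    field
      cong   : ∀ {f g} → f ≈E g → L f ≈E L g
      +-homo : ∀ f g → L (f +E g) ≈E (L f +E L g)
      ·-homo : ∀ r f → L (r ·E f) ≈E (r ·E L f)

    0-homo : ∀ {f} → f ≈E 0E → L f ≈E 0E
    0-homo {f} f≈0 S =
      trans (cong (λ T → trans (f≈0 T) (sym (zeroˡ (f T)))) S) (trans (·-homo 0# f S) (zeroˡ _))

    -‿homo : ∀ f → L (-E f) ≈E (-E L f)
    -‿homo f S =
      trans (cong (λ T → sym (-1*x≈-x (f T))) S) (trans (·-homo (- 1#) f S) (-1*x≈-x _))

    negPow-homo : ∀ k f → L (λ T → negPow k (f T)) ≈E (λ S → negPow k (L f S))
    negPow-homo zero    f S = refl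
    negPow-homo (suc k) f S =
      trans (-‿homo (λ T → negPow k (f T)) S) (-‿cong (negPow-homo k f S))

    ·-−-homo : ∀ r g h → L (λ T → r * g T - h T) ≈E (λ S → r * L g S - L h S)
    ·-−-homo r g h S = trans (+-homo (λ T → r * g T) (λ T → - h T) S) (+-cong (·-homo r g S) (-‿homo h S))

    sum-homo : ∀ {m} (g : Fin m → Ext) → L (λ T → sum (λ t → g t T)) ≈E (λ S → sum (λ t → L (g t) S))
    sum-homo {zero}  g = 0-homo (λ T → refl)
    sum-homo {suc m} g S =
      trans (+-homo (g zero) (λ T → sum (λ t → g (suc t) T)) S) (+-congˡ (sum-homo (g ∘ suc) S))

  ∘-linear : ∀ {L L′} → IsLinear L → IsLinear L′ → IsLinear (L ∘ L′)
  ∘-linear {L} {L′} lin lin′ = record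
    { cong   = λ f≈g → L.cong (L′.cong f≈g)
    ; +-homo = λ f g S → trans (L.cong (L′.+-homo f g) S) (L.+-homo (L′ f) (L′ g) S)
    ; ·-homo = λ r f S → trans (L.cong (L′.·-homo r f) S) (L.·-homo r (L′ f) S)
    }
    where
    module L  = IsLinear lin
    module L′ = IsLinear lin′

  combination-linear : ∀ {m} (a : Fin m → Carrier) (L : Fin m → Ext → Ext) →
    (∀ i → IsLinear (L i)) → IsLinear (λ f S → sum (λ i → a i * L i f S))
  combination-linear a L lin = record
    { cong   = λ f≈g S → sum-cong-≋ (λ i → *-congˡ (IsLinear.cong (lin i) f≈g S))
    ; +-homo = λ f g S → trans (sum-cong-≋ (λ i → trans (*-congˡ (IsLinear.+-homo (lin i) f g S))
                                                       (distribˡ (a i) _ _)))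
                               (sum-+ (λ i → a i * L i f S) (λ i → a i * L i g S))
    ; ·-homo = λ r f S → trans (sum-cong-≋ (λ i → trans (*-congˡ (IsLinear.·-homo (lin i) r f S))
                                                       (x∙yz≈y∙xz (a i) r _)))
                               (sym (*-distribˡ-sum r (λ i → a i * L i f S)))
    }

  guardedSign-linear : (g : Subset n → Bool) (k : Subset n → ℕ) (h : Subset n → Subset n) →
    IsLinear (λ f T → if g T then negPow (k T) (f (h T)) else 0#)
  guardedSign-linear g k h = record { cong = cong′ ; +-homo = +-homo′ ; ·-homo = ·-homo′ }
    where
    cong′ : ∀ {f f′} → f ≈E f′ → ∀ T →
      (if g T then negPow (k T) (f (h T)) else 0#) ≈ (if g T then negPow (k T) (f′ (h T)) else 0#)
    cong′ f≈f′ T with g T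
    ... | true  = negPow-cong (k T) (f≈f′ (h T))
    ... | false = refl
    +-homo′ : ∀ f f′ T → (if g T then negPow (k T) (f (h T) + f′ (h T)) else 0#)
      ≈ (if g T then negPow (k T) (f (h T)) else 0#) + (if g T then negPow (k T) (f′ (h T)) else 0#)
    +-homo′ f f′ T with g T
    ... | true  = negPow-+ (k T) _ _
    ... | false = sym (+-identityʳ 0#)
    ·-homo′ : ∀ r f T → (if g T then negPow (k T) (r * f (h T)) else 0#)
      ≈ r * (if g T then negPow (k T) (f (h T)) else 0#)
    ·-homo′ r f T with g T
    ... | true  = negPow-* (k T) r _
    ... | false = sym (zeroʳ r)

  eMul-linear : ∀ i → IsLinear (eMul i)
  eMul-linear i = guardedSign-linear (λ T → lookup T i) (λ T → ∣ T ∩ below i ∣) (_─ ⁅ i ⁆)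

  module EMul (i : Fin n) = IsLinear (eMul-linear i)

  lmul : E₁ → Ext → Ext
  lmul u f S = sum (λ i → u i * eMul i f S)

  lmul-linear : ∀ u → IsLinear (lmul u)
  lmul-linear u = combination-linear u eMul eMul-linear

  module Lmul (u : E₁) = IsLinear (lmul-linear u)

  lmul-δ : ∀ i f → lmul (δ i) f ≈E eMul i f
  lmul-δ i f S = sum-δ i (λ j → eMul j f S)

module ExteriorRelations {c ℓ} (K : Field c ℓ) where
  open Field K hiding (zero)
  open Scalars K
  open LinearMaps K using (lmul)
  open import Relation.Binary.Reasoning.Setoid setoid
  open import Data.Vec.Properties using (tabulate-cong; tabulate∘lookup; lookup-replicate)

  -- Splitting subsets of {0,…,n} by whether they contain 0 reduces e₀ to a shift of
  -- coefficients and e_{i+1} to the generator e_i over n variables, with an extra sign when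
  -- 0 ∈ S; both exterior relations then follow by induction on n.
  module HeadBit (n : ℕ) where
    open Exterior K (suc n) using (eMul; below)
    open Exterior K n using () renaming (eMul to eMulₙ; below to belowₙ)

    below-zero : below zero ≡ Sub.⊥
    below-zero = ≡.trans (tabulate-cong (λ k → ≡.sym (lookup-replicate k false))) (tabulate∘lookup Sub.⊥)

    eMul-zero-inside : ∀ f S → eMul zero f (true ∷ S) ≈ f (false ∷ S)
    eMul-zero-inside f S = reflexive (≡.cong₂ (λ k T → Exterior.negPow K (suc n) k (f (false ∷ T)))
      (≡.trans (≡.cong (λ b → ∣ S ∩ b ∣) (≡.cong Vec.tail below-zero))
               (≡.trans (≡.cong ∣_∣ (∩-zeroʳ S)) (∣⊥∣≡0 n)))
      (p─⊥≡p S))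

    eMul-suc-outside : ∀ i f S → eMul (suc i) f (false ∷ S) ≈ eMulₙ i (λ T → f (false ∷ T)) S
    eMul-suc-outside i f S with lookup S i
    ... | true  = reflexive (Signs.negPow-indep K (suc n) n ∣ S ∩ belowₙ i ∣ (f (false ∷ (S ─ ⁅ i ⁆))))
    ... | false = refl

    eMul-suc-inside : ∀ i f S → eMul (suc i) f (true ∷ S) ≈ - eMulₙ i (λ T → f (true ∷ T)) S
    eMul-suc-inside i f S with lookup S i
    ... | true  = -‿cong (reflexive (Signs.negPow-indep K (suc n) n ∣ S ∩ belowₙ i ∣ (f (true ∷ (S ─ ⁅ i ⁆)))))
    ... | false = sym -0#≈0#

    private
      lmul⁺ = lmul (suc n)
      lmulₙ = lmul n
      module Lmulₙ = LinearMaps.Lmul K n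

    lmul-outside : ∀ u f S → lmul⁺ u f (false ∷ S) ≈ lmulₙ (u ∘ suc) (λ T → f (false ∷ T)) S
    lmul-outside u f S =
      trans (+-cong (zeroʳ (u zero)) (sum-cong-≋ (λ i → *-congˡ (eMul-suc-outside i f S)))) (+-identityˡ _)

    lmul-inside : ∀ u f S →
      lmul⁺ u f (true ∷ S) ≈ u zero * f (false ∷ S) - lmulₙ (u ∘ suc) (λ T → f (true ∷ T)) S
    lmul-inside u f S = +-cong (*-congˡ (eMul-zero-inside f S))
      (trans (sum-cong-≋ (λ i → trans (*-congˡ (eMul-suc-inside i f S)) (sym (-‿distribʳ-* _ _))))
             (sum-neg (λ i → u (suc i) * eMulₙ i (λ T → f (true ∷ T)) S)))

    lmul²-outside : ∀ u w f S → lmul⁺ u (lmul⁺ w f) (false ∷ S) ≈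
      lmulₙ (u ∘ suc) (lmulₙ (w ∘ suc) (λ T → f (false ∷ T))) S
    lmul²-outside u w f S =
      trans (lmul-outside u (lmul⁺ w f) S) (Lmulₙ.cong (u ∘ suc) (lmul-outside w f) S)

    lmul²-inside : ∀ u w f S → let f₀ = λ T → f (false ∷ T); f₁ = λ T → f (true ∷ T) in
      lmul⁺ u (lmul⁺ w f) (true ∷ S) ≈
      u zero * lmulₙ (w ∘ suc) f₀ S - (w zero * lmulₙ (u ∘ suc) f₀ S - lmulₙ (u ∘ suc) (lmulₙ (w ∘ suc) f₁) S)
    lmul²-inside u w f S = trans (lmul-inside u (lmul⁺ w f) S)
      (+-cong (*-congˡ (lmul-outside w f S))
        (-‿cong (trans (Lmulₙ.cong (u ∘ suc) (lmul-inside w f) S)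
                       (Lmulₙ.·-−-homo (u ∘ suc) (w zero) (λ T → f (false ∷ T))
                                       (lmulₙ (w ∘ suc) (λ T → f (true ∷ T))) S))))

  lmul-anticomm-sum : ∀ n u w (f : Exterior.Ext K n) S → lmul n u (lmul n w f) S + lmul n w (lmul n u f) S ≈ 0#
  lmul-anticomm-sum zero    u w f S = +-identityʳ 0#
  lmul-anticomm-sum (suc n) u w f (false ∷ S) =
    trans (+-cong (lmul²-outside u w f S) (lmul²-outside w u f S))
          (lmul-anticomm-sum n (u ∘ suc) (w ∘ suc) (λ T → f (false ∷ T)) S)
    where open HeadBit n
  lmul-anticomm-sum (suc n) u w f (true ∷ S) =
    trans (+-cong (lmul²-inside u w f S) (lmul²-inside w u f S))
          (trans ([x-[y-z]]+[y-[x-w]]≈z+w _ _ _ _)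
                 (lmul-anticomm-sum n (u ∘ suc) (w ∘ suc) (λ T → f (true ∷ T)) S))
    where open HeadBit n

  lmul-square : ∀ n u (f : Exterior.Ext K n) S → lmul n u (lmul n u f) S ≈ 0#
  lmul-square zero    u f S = refl
  lmul-square (suc n) u f (false ∷ S) =
    trans (lmul²-outside u u f S) (lmul-square n (u ∘ suc) (λ T → f (false ∷ T)) S)
    where open HeadBit n
  lmul-square (suc n) u f (true ∷ S) =
    trans (lmul²-inside u u f S) (trans (x-[x-y]≈y _ _) (lmul-square n (u ∘ suc) (λ T → f (true ∷ T)) S))
    where open HeadBit n

module ExteriorLaws {c ℓ} (K : Field c ℓ) (n : ℕ) where
  open Field K hiding (zero)
  open Scalars K
  open Signs K n
  open Exterior K n
  open LinearMaps K n
  open ExteriorRelations K using (lmul-anticomm-sum; lmul-square)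
  open import Relation.Binary.Reasoning.Setoid setoid

  lmul-anticomm : ∀ u w f → lmul u (lmul w f) ≈E (-E lmul w (lmul u f))
  lmul-anticomm u w f S = +-inverseˡ-unique _ _ (lmul-anticomm-sum n u w f S)

  eMul-anticomm : ∀ i k f → eMul i (eMul k f) ≈E (-E eMul k (eMul i f))
  eMul-anticomm i k f S = begin
    eMul i (eMul k f) S         ≈⟨ lmul-δ i (eMul k f) S ⟨
    lmul (δ i) (eMul k f) S     ≈⟨ Lmul.cong (δ i) (λ T → sym (lmul-δ k f T)) S ⟩
    lmul (δ i) (lmul (δ k) f) S ≈⟨ lmul-anticomm (δ i) (δ k) f S ⟩
    - lmul (δ k) (lmul (δ i) f) S ≈⟨ -‿cong (Lmul.cong (δ k) (lmul-δ i f) S) ⟩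
    - lmul (δ k) (eMul i f) S   ≈⟨ -‿cong (lmul-δ k (eMul i f) S) ⟩
    - eMul k (eMul i f) S       ∎

  lmulProd : ℕ → (ℕ → E₁) → Ext → Ext
  lmulProd zero    u f = f
  lmulProd (suc k) u f = lmul (u 0) (lmulProd k (u ∘ suc) f)

  lmulProd-linear : ∀ k u → IsLinear (lmulProd k u)
  lmulProd-linear zero    u = record { cong = λ f≈g → f≈g ; +-homo = λ _ _ _ → refl ; ·-homo = λ _ _ _ → refl }
  lmulProd-linear (suc k) u = ∘-linear (lmul-linear (u 0)) (lmulProd-linear k (u ∘ suc))

  module LmulProd (k : ℕ) (u : ℕ → E₁) = IsLinear (lmulProd-linear k u)

  lmulProd-snoc : ∀ k u f → lmulProd (suc k) u f ≈E lmulProd k u (lmul (u k) f)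
  lmulProd-snoc zero    u f S = refl
  lmulProd-snoc (suc k) u f   = Lmul.cong (u 0) (lmulProd-snoc k (u ∘ suc) f)

  lmulProd-sign : ∀ k u w f → lmulProd k u (lmul w f) ≈E (λ S → negPow k (lmul w (lmulProd k u f) S))
  lmulProd-sign zero    u w f S = refl
  lmulProd-sign (suc k) u w f S = begin
    lmul (u 0) (lmulProd k (u ∘ suc) (lmul w f)) S  ≈⟨ Lmul.cong (u 0) (lmulProd-sign k (u ∘ suc) w f) S ⟩
    lmul (u 0) (λ T → negPow k (lmul w P T)) S      ≈⟨ Lmul.negPow-homo (u 0) k (lmul w P) S ⟩
    negPow k (lmul (u 0) (lmul w P) S)              ≈⟨ negPow-cong k (lmul-anticomm (u 0) w P S) ⟩
    negPow k (- lmul w (lmul (u 0) P) S)            ≈⟨ negPow-neg k _ ⟩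
    - negPow k (lmul w (lmul (u 0) P) S)            ∎
    where P = lmulProd k (u ∘ suc) f

  lmulProd-annihilates : ∀ k u (t : Fin k) f → lmulProd k u (lmul (u (toℕ t)) f) ≈E 0E
  lmulProd-annihilates (suc k) u zero    f S = begin
    lmul (u 0) (lmulProd k (u ∘ suc) (lmul (u 0) f)) S ≈⟨ Lmul.cong (u 0) (lmulProd-sign k (u ∘ suc) (u 0) f) S ⟩
    lmul (u 0) (λ T → negPow k (lmul (u 0) P T)) S     ≈⟨ Lmul.negPow-homo (u 0) k (lmul (u 0) P) S ⟩
    negPow k (lmul (u 0) (lmul (u 0) P) S)             ≈⟨ negPow-zero k (lmul-square n (u 0) P S) ⟩
    0#                                                 ∎
    where P = lmulProd k (u ∘ suc) f
  lmulProd-annihilates (suc k) u (suc t) f = Lmul.0-homo (u 0) (lmulProd-annihilates k (u ∘ suc) t f)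

  lmul-lmulProd-annihilates : ∀ k u (t : Fin k) f → lmul (u (toℕ t)) (lmulProd k u f) ≈E 0E
  lmul-lmulProd-annihilates k u t f S =
    negPow≈0⇒≈0 k (trans (sym (lmulProd-sign k u (u (toℕ t)) f S)) (lmulProd-annihilates k u t f S))

  eMul-homog : ∀ i {k f} → Homog k f → Homog (ℤ.suc k) (eMul i f)
  eMul-homog i {k} {f} hf T ∣T∣≢k+1 with lookup T i in i∈T
  ... | true  = negPow-zero ∣ T ∩ below i ∣ (hf (T ─ ⁅ i ⁆)
                  (λ ∣T-i∣≡k → ∣T∣≢k+1 (≡.trans (≡.cong ℤ.+_ (∣p∣≡suc∣p-x∣ T i i∈T)) (≡.cong ℤ.suc ∣T-i∣≡k))))
  ... | false = refl

  +E-homog : ∀ {k f g} → Homog k f → Homog k g → Homog k (f +E g)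
  +E-homog hf hg S ∣S∣≢k = trans (+-cong (hf S ∣S∣≢k) (hg S ∣S∣≢k)) (+-identityʳ 0#)

  ·E-homog : ∀ {k f} r → Homog k f → Homog k (r ·E f)
  ·E-homog r hf S ∣S∣≢k = trans (*-congˡ (hf S ∣S∣≢k)) (zeroʳ r)

module Homomorphisms {c ℓ} (K : Field c ℓ) (n : ℕ) {a p} (N : Exterior.GData K n a p) where
  open Field K hiding (zero)
  open Scalars K
  open Signs K n
  open Exterior K n
  open LinearMaps K n
  open ExteriorLaws K n
  open import Relation.Binary.Reasoning.Setoid setoid
  import Algebra.Properties.CommutativeSemigroup
  open GData N using (C)

  Hom-+ : ∀ {j φ ψ} → IsHom N j φ → IsHom N j ψ → IsHom N j (λ d x → φ d x +E ψ d x)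
  Hom-+ {j} {φ} {ψ} hφ hψ = record
    { cong  = λ d x y ix iy x≈y S → +-cong (φ.cong d x y ix iy x≈y S) (ψ.cong d x y ix iy x≈y S)
    ; hom-+ = λ d x y ix iy S →
        trans (+-cong (φ.hom-+ d x y ix iy S) (ψ.hom-+ d x y ix iy S)) (interchange _ _ _ _)
    ; hom-· = λ d r x ix S →
        trans (+-cong (φ.hom-· d r x ix S) (ψ.hom-· d r x ix S)) (sym (distribˡ r _ _))
    ; homog = λ d x ix → +E-homog (φ.homog d x ix) (ψ.homog d x ix)
    ; hom-e = λ i d x ix S → trans (+-cong (φ.hom-e i d x ix S) (ψ.hom-e i d x ix S))
        (trans (sym (negPow-+ ℤ.∣ j ∣ _ _)) (negPow-cong ℤ.∣ j ∣ (sym (EMul.+-homo i (φ d x) (ψ d x) S))))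
    }
    where
    module φ = IsHom hφ
    module ψ = IsHom hψ

  Hom-· : ∀ {j φ} r → IsHom N j φ → IsHom N j (λ d x → r ·E φ d x)
  Hom-· {j} {φ} r hφ = record
    { cong  = λ d x y ix iy x≈y S → *-congˡ (φ.cong d x y ix iy x≈y S)
    ; hom-+ = λ d x y ix iy S → trans (*-congˡ (φ.hom-+ d x y ix iy S)) (distribˡ r _ _)
    ; hom-· = λ d s x ix S → trans (*-congˡ (φ.hom-· d s x ix S)) (x∙yz≈y∙xz r s _)
    ; homog = λ d x ix → ·E-homog r (φ.homog d x ix)
    ; hom-e = λ i d x ix S → trans (*-congˡ (φ.hom-e i d x ix S))
        (trans (sym (negPow-* ℤ.∣ j ∣ r _)) (negPow-cong ℤ.∣ j ∣ (sym (EMul.·-homo i r (φ d x) S))))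
    }
    where module φ = IsHom hφ

  Hom-0 : ∀ {j} → IsHom N j (λ d x → 0E)
  Hom-0 {j} = record
    { cong  = λ d x y ix iy x≈y S → refl
    ; hom-+ = λ d x y ix iy S → sym (+-identityʳ 0#)
    ; hom-· = λ d r x ix S → sym (zeroʳ r)
    ; homog = λ d x ix S _ → refl
    ; hom-e = λ i d x ix S → sym (negPow-zero ℤ.∣ j ∣ (EMul.0-homo i (λ _ → refl) S))
    }

  Hom-sum : ∀ {j k} (φ : Fin k → (d : ℤ) → C d → Ext) → (∀ t → IsHom N j (φ t)) →
            IsHom N j (λ d x S → sum (λ t → φ t d x S))
  Hom-sum {k = zero}  φ hφ = Hom-0
  Hom-sum {k = suc k} φ hφ = Hom-+ (hφ zero) (Hom-sum (φ ∘ suc) (hφ ∘ suc))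

  Hom-eMul : ∀ {j φ} i → IsHom N j φ → IsHom N (ℤ.suc j) (λ d x → eMul i (φ d x))
  Hom-eMul {j} {φ} i hφ = record
    { cong  = λ d x y ix iy x≈y → EMul.cong i (φ.cong d x y ix iy x≈y)
    ; hom-+ = λ d x y ix iy S → trans (EMul.cong i (φ.hom-+ d x y ix iy) S) (EMul.+-homo i (φ d x) (φ d y) S)
    ; hom-· = λ d r x ix S → trans (EMul.cong i (φ.hom-· d r x ix) S) (EMul.·-homo i r (φ d x) S)
    ; homog = λ d x ix → ≡.subst (λ k → Homog k (eMul i (φ d x))) (ℤ+.x∙yz≈y∙xz (ℤ.+ 1) d j)
                                 (eMul-homog i (φ.homog d x ix))
    ; hom-e = λ k d x ix S → begin
        eMul i (φ (ℤ.suc d) (GData.act N k d x)) S    ≈⟨ EMul.cong i (φ.hom-e k d x ix) S ⟩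
        eMul i (λ T → sgn j (eMul k (φ d x) T)) S     ≈⟨ EMul.negPow-homo i ℤ.∣ j ∣ (eMul k (φ d x)) S ⟩
        sgn j (eMul i (eMul k (φ d x)) S)             ≈⟨ negPow-cong ℤ.∣ j ∣ (eMul-anticomm i k (φ d x) S) ⟩
        sgn j (- eMul k (eMul i (φ d x)) S)           ≈⟨ negPow-neg ℤ.∣ j ∣ _ ⟩
        - sgn j (eMul k (eMul i (φ d x)) S)           ≈⟨ sgn-suc j _ ⟨
        sgn (ℤ.suc j) (eMul k (eMul i (φ d x)) S)     ∎
    }
    where
    module φ = IsHom hφ
    module ℤ+ = Algebra.Properties.CommutativeSemigroup ℤ.+-commutativeSemigroup

  Hom-lmul : ∀ {j φ} u → IsHom N j φ → IsHom N (ℤ.suc j) (λ d x → lmul u (φ d x))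
  Hom-lmul {φ = φ} u hφ = Hom-sum (λ i d x S → u i * eMul i (φ d x) S) (λ i → Hom-· (u i) (Hom-eMul i hφ))

module GradedModuleLemmas {c ℓ m ℓm} (K : Field c ℓ) (n : ℕ) (M : Exterior.GradedModule K n m ℓm) where
  open Field K hiding (zero)
  open Exterior K n
  open import Algebra.Module.Bundles using (Module)

  module GM = GradedModule M
  module Mod (d : ℤ) = Module (GM.Mod d)

  N : GData m ℓm
  N = GM.data′

  module _ (d : ℤ) where
    open Mod d

    −g-≈0 : ∀ {x y} → x ≈ᴹ y → _−g_ N {d} x y ≈ᴹ 0ᴹ
    −g-≈0 {x} {y} x≈y = ≈ᴹ-trans (+ᴹ-cong (≈ᴹ-sym (*ₗ-identityˡ x)) (*ₗ-congˡ (≈ᴹ-sym x≈y)))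
      (≈ᴹ-trans (≈ᴹ-sym (*ₗ-distribʳ x 1# (- 1#))) (≈ᴹ-trans (*ₗ-congʳ (-‿inverseʳ 1#)) (*ₗ-zeroˡ x)))

    −g-+-cancel : ∀ x y → (_−g_ N {d} x y) +ᴹ y ≈ᴹ x
    −g-+-cancel x y = ≈ᴹ-trans (+ᴹ-assoc x _ y)
      (≈ᴹ-trans (+ᴹ-congˡ (≈ᴹ-trans (+ᴹ-congˡ (≈ᴹ-sym (*ₗ-identityˡ y)))
        (≈ᴹ-trans (≈ᴹ-sym (*ₗ-distribʳ y (- 1#) 1#)) (≈ᴹ-trans (*ₗ-congʳ (-‿inverseˡ 1#)) (*ₗ-zeroˡ y)))))
        (+ᴹ-identityʳ x))

    −g-0 : ∀ x → _−g_ N {d} x 0ᴹ ≈ᴹ x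
    −g-0 x = ≈ᴹ-trans (+ᴹ-congˡ (*ₗ-zeroʳ (- 1#))) (+ᴹ-identityʳ x)

    sumFin-zero : ∀ {k} (z : Fin k → Carrierᴹ) → (∀ t → z t ≈ᴹ 0ᴹ) → sumFin N {d} z ≈ᴹ 0ᴹ
    sumFin-zero {zero}  z z≈0 = ≈ᴹ-refl
    sumFin-zero {suc k} z z≈0 = ≈ᴹ-trans (+ᴹ-cong (z≈0 zero) (sumFin-zero (z ∘ suc) (z≈0 ∘ suc))) (+ᴹ-identityʳ 0ᴹ)

  act-zero : ∀ i d → Mod._≈ᴹ_ (ℤ.suc d) (GM.act i d (Mod.0ᴹ d)) (Mod.0ᴹ (ℤ.suc d))
  act-zero i d = Mod.≈ᴹ-trans (ℤ.suc d) (GM.act-cong i d (Mod.≈ᴹ-sym d (Mod.*ₗ-zeroˡ d (Mod.0ᴹ d))))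
    (Mod.≈ᴹ-trans (ℤ.suc d) (GM.act-· i d 0# (Mod.0ᴹ d)) (Mod.*ₗ-zeroˡ (ℤ.suc d) _))

  actV-zero : ∀ u d → Mod._≈ᴹ_ (ℤ.suc d) (actV N u d (Mod.0ᴹ d)) (Mod.0ᴹ (ℤ.suc d))
  actV-zero u d = sumFin-zero (ℤ.suc d) _
    (λ i → Mod.≈ᴹ-trans (ℤ.suc d) (Mod.*ₗ-congˡ (ℤ.suc d) (act-zero i d)) (Mod.*ₗ-zeroʳ (ℤ.suc d) (u i)))

  subst-zero : ∀ {d′ d} (eq : d′ ≡ d) {x} → Mod._≈ᴹ_ d′ x (Mod.0ᴹ d′) →
               Mod._≈ᴹ_ d (≡.subst (GData.C N) eq x) (Mod.0ᴹ d)
  subst-zero ≡.refl x≈0 = x≈0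

  single : ∀ {k d} → Fin k → GData.C N d → Fin k → GData.C N d
  single zero    x zero    = x
  single zero    x (suc t) = Mod.0ᴹ _
  single (suc i) x zero    = Mod.0ᴹ _
  single (suc i) x (suc t) = single i x t

  sumFin-actV-single : ∀ {k} (w : Fin k → E₁) (i : Fin k) d x →
    Mod._≈ᴹ_ (ℤ.suc d) (sumFin N (λ t → actV N (w t) d (single i x t))) (actV N (w i) d x)
  sumFin-actV-single w zero    d x = Mod.≈ᴹ-trans (ℤ.suc d)
    (Mod.+ᴹ-congˡ (ℤ.suc d) (sumFin-zero (ℤ.suc d) _ (λ t → actV-zero (w (suc t)) d))) (Mod.+ᴹ-identityʳ (ℤ.suc d) _)
  sumFin-actV-single w (suc i) d x = Mod.≈ᴹ-trans (ℤ.suc d) (Mod.+ᴹ-congʳ (ℤ.suc d) (actV-zero (w zero) d))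
    (Mod.≈ᴹ-trans (ℤ.suc d) (Mod.+ᴹ-identityˡ (ℤ.suc d) _) (sumFin-actV-single (w ∘ suc) i d x))

extend : ∀ {a} {A : Set a} {s} → (Fin s → A) → A → ℕ → A
extend {s = zero}  v a t       = a
extend {s = suc s} v a zero    = v zero
extend {s = suc s} v a (suc t) = extend (v ∘ suc) a t

extend-toℕ : ∀ {a} {A : Set a} {s} (v : Fin s → A) a (t : Fin s) → extend v a (toℕ t) ≡ v t
extend-toℕ v a zero    = ≡.refl
extend-toℕ v a (suc t) = extend-toℕ (v ∘ suc) a t

snoc : ∀ {a} {A : Set a} {k} → (Fin k → A) → A → Fin (suc k) → A
snoc {k = zero}  z y zero    = y
snoc {k = suc k} z y zero    = z zero
snoc {k = suc k} z y (suc t) = snoc (z ∘ suc) y t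

snoc-all : ∀ {a p} {A : Set a} (P : A → Set p) {k} (z : Fin k → A) y →
           (∀ t → P (z t)) → P y → ∀ t → P (snoc z y t)
snoc-all P {zero}  z y Pz Py zero    = Py
snoc-all P {suc k} z y Pz Py zero    = Pz zero
snoc-all P {suc k} z y Pz Py (suc t) = snoc-all P (z ∘ suc) y (Pz ∘ suc) Py t

module QuotientSums {c ℓ} (K : Field c ℓ) (n : ℕ) where
  open Exterior K n

  sumFin-quot : ∀ {a p k} (X : GData a p) (w : Fin k → E₁) {d m} (z : Fin m → GData.C X d) →
                sumFin (quot X w) z ≡ sumFin X z
  sumFin-quot X w {m = zero}  z = ≡.refl
  sumFin-quot X w {m = suc m} z = ≡.cong (GData._+g_ X (z zero)) (sumFin-quot X w (z ∘ suc))

module Duality {c ℓ m ℓm} (K : Field c ℓ) (n : ℕ) (M : Exterior.GradedModule K n m ℓm) where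
  open Field K hiding (zero)
  open Scalars K
  open Signs K n
  open Exterior K n
  open LinearMaps K n
  open ExteriorLaws K n
  open GradedModuleLemmas K n M
  open Homomorphisms K n N
  open import Relation.Binary.Reasoning.Setoid setoid
  open import Algebra.Properties.AbelianGroup ℤ.+-0-abelianGroup using () renaming (∙-cancelˡ to ℤ-cancelˡ)

  D : GData (m ⊔ c) (m ⊔ ℓm ⊔ ℓ ⊔ c)
  D = dual N

  Φ : Set (c ⊔ m)
  Φ = (d : ℤ) → GData.C N d → Ext

  _≈Φ_ : Φ → Φ → Set (ℓ ⊔ m)
  φ ≈Φ ψ = ∀ d x → φ d x ≈E ψ d x

  0Φ : Φ
  0Φ d x = 0E

  -- Definitionally the difference _−g_ of the dual, through which quotients of D compare maps.
  _−Φ_ : Φ → Φ → Φ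
  (φ −Φ ψ) d x = φ d x +E ((- 1#) ·E ψ d x)

  lmulΦ : E₁ → Φ → Φ
  lmulΦ u φ d x = lmul u (φ d x)

  lmulProdΦ : ℕ → (ℕ → E₁) → Φ → Φ
  lmulProdΦ k u φ d x = lmulProd k u (φ d x)

  hom-0ᴹ : ∀ {j φ} → IsHom N j φ → ∀ d → φ d (Mod.0ᴹ d) ≈E 0E
  hom-0ᴹ {φ = φ} hφ d S = trans (IsHom.cong hφ d _ _ _ _ (Mod.≈ᴹ-sym d (Mod.*ₗ-zeroˡ d (Mod.0ᴹ d))) S)
    (trans (IsHom.hom-· hφ d 0# (Mod.0ᴹ d) _ S) (zeroˡ _))

  hom-sumFin : ∀ {j φ} → IsHom N j φ → ∀ {d k} (z : Fin k → GData.C N d) →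
               φ d (sumFin N z) ≈E (λ S → sum (λ t → φ d (z t) S))
  hom-sumFin hφ {d} {zero}  z = hom-0ᴹ hφ d
  hom-sumFin hφ {d} {suc k} z S = trans (IsHom.hom-+ hφ d _ _ _ _ S) (+-congˡ (hom-sumFin hφ (z ∘ suc) S))

  hom-actV : ∀ {j φ} → IsHom N j φ → ∀ u d x → φ (ℤ.suc d) (actV N u d x) ≈E (λ S → sgn j (lmul u (φ d x) S))
  hom-actV {j} {φ} hφ u d x S = begin
    φ (ℤ.suc d) (actV N u d x) S
      ≈⟨ hom-sumFin hφ (λ i → Mod._*ₗ_ (ℤ.suc d) (u i) (GM.act i d x)) S ⟩
    sum (λ i → φ (ℤ.suc d) (Mod._*ₗ_ (ℤ.suc d) (u i) (GM.act i d x)) S)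
      ≈⟨ sum-cong-≋ (λ i → trans (IsHom.hom-· hφ (ℤ.suc d) (u i) _ _ S)
           (trans (*-congˡ (IsHom.hom-e hφ i d x _ S)) (sym (negPow-* ℤ.∣ j ∣ (u i) _)))) ⟩
    sum (λ i → sgn j (u i * eMul i (φ d x) S))  ≈⟨ negPow-sum ℤ.∣ j ∣ (λ i → u i * eMul i (φ d x) S) ⟩
    sgn j (lmul u (φ d x) S)                                       ∎

  sumFin-dual : ∀ {j k} (z : Fin k → Φ) d x S → sumFin D {j} z d x S ≡ sum (λ t → z t d x S)
  sumFin-dual {k = zero}  z d x S = ≡.refl
  sumFin-dual {k = suc k} z d x S = ≡.cong (z zero d x S +_) (sumFin-dual (z ∘ suc) d x S)

  actV-dual : ∀ u j φ d x S → actV D u j φ d x S ≡ lmul u (φ d x) S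
  actV-dual u j φ d x S = sumFin-dual {j = ℤ.suc j} (λ i d x S → u i * eMul i (φ d x) S) d x S

  actV-quot-dual : ∀ {k} (w : Fin k → E₁) u j φ d x S → actV (quot D w) u j φ d x S ≡ lmul u (φ d x) S
  actV-quot-dual w u j φ d x S = ≡.trans
    (≡.cong (λ χ → χ d x S)
            (QuotientSums.sumFin-quot K n D w (λ i → GData._·g_ D {ℤ.suc j} (u i) (GData.act D i j φ))))
    (actV-dual u j φ d x S)

  subst-dual : ∀ {j j′} (eq : j ≡ j′) (φ : Φ) → ≡.subst (GData.C D) eq φ ≡ φ
  subst-dual ≡.refl φ = ≡.refl

  actProd-dual : ∀ {k} (w : Fin k → E₁) (u : ℕ → E₁) → (∀ t → u (toℕ t) ≡ w t) →
                 ∀ d′ ψ → actProd D w d′ ψ ≈Φ (λ d x → lmulProd k u (ψ d x))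
  actProd-dual {zero}  w u u≡w d′ ψ d x S = refl
  actProd-dual {suc k} w u u≡w d′ ψ d x S = begin
    actV D (w zero) (sucⁿ k d′) (actProd D (w ∘ suc) d′ ψ) d x S
      ≡⟨ actV-dual (w zero) (sucⁿ k d′) (actProd D (w ∘ suc) d′ ψ) d x S ⟩
    lmul (w zero) (actProd D (w ∘ suc) d′ ψ d x) S
      ≈⟨ Lmul.cong (w zero) (actProd-dual (w ∘ suc) (u ∘ suc) (u≡w ∘ suc) d′ ψ d x) S ⟩
    lmul (w zero) (lmulProd k (u ∘ suc) (ψ d x)) S
      ≡⟨ ≡.cong (λ u₀ → lmul u₀ (lmulProd k (u ∘ suc) (ψ d x)) S) (u≡w zero) ⟨
    lmul (u 0) (lmulProd k (u ∘ suc) (ψ d x)) S ∎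

  combination : ∀ {k} → (ℕ → E₁) → (Fin k → Φ) → Φ
  combination u z d x S = sum (λ t → lmul (u (toℕ t)) (z t d x) S)

  sum-snoc : ∀ {k} u (z : Fin k → Φ) y d x S →
    combination u (snoc z y) d x S ≈ combination u z d x S + lmul (u k) (y d x) S
  sum-snoc {zero}  u z y d x S = +-comm _ _
  sum-snoc {suc k} u z y d x S = trans (+-congˡ (sum-snoc (u ∘ suc) (z ∘ suc) y d x S)) (sym (+-assoc _ _ _))

  record InIdeal (k : ℕ) (u : ℕ → E₁) (j : ℤ) (φ : Φ) : Set (c ⊔ ℓ ⊔ m ⊔ ℓm) where
    constructor combination-of
    field
      degree       : ℤ
      degree-suc   : ℤ.suc degree ≡ j
      coefficients : Fin k → Φ
      coefficients-hom : ∀ t → IsHom N degree (coefficients t)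
      ≈combination : φ ≈Φ combination u coefficients

  InIdeal-resp : ∀ {k u j φ ψ} → φ ≈Φ ψ → InIdeal k u j ψ → InIdeal k u j φ
  InIdeal-resp φ≈ψ (combination-of j′ eq z hz ψ≈) = combination-of j′ eq z hz λ d x S → trans (φ≈ψ d x S) (ψ≈ d x S)

  InIdeal-zero : ∀ u j {φ} → φ ≈Φ 0Φ → InIdeal 0 u j φ
  InIdeal-zero u j φ≈0 = combination-of (ℤ.pred j) (ℤ.suc-pred j) (λ ()) (λ ()) φ≈0

  InIdeal-snoc : ∀ {k u j j′ φ y} → InIdeal k u j φ → IsHom N j′ y → ℤ.suc j′ ≡ j →
                 InIdeal (suc k) u j (λ d x → φ d x +E lmul (u k) (y d x))
  InIdeal-snoc {k} {u} {j} {j′} {φ} {y} (combination-of j″ eq″ z hz φ≈) hy eq =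
    combination-of j″ eq″ (snoc z y) (snoc-all (IsHom N j″) z y hz (≡.subst (λ i → IsHom N i y) j′≡j″ hy))
    λ d x S → trans (+-congʳ (φ≈ d x S)) (sym (sum-snoc u z y d x S))
    where
    j′≡j″ : j′ ≡ j″
    j′≡j″ = ℤ-cancelˡ (ℤ.+ 1) j′ j″ (≡.trans eq (≡.sym eq″))

  InIdeal⇒lmulProd≈0 : ∀ {k u j φ} → InIdeal k u j φ → lmulProdΦ k u φ ≈Φ 0Φ
  InIdeal⇒lmulProd≈0 {k} {u} (combination-of j′ eq z hz φ≈) d x S =
    trans (LmulProd.cong k u (φ≈ d x) S)
      (trans (LmulProd.sum-homo k u (λ t → lmul (u (toℕ t)) (z t d x)) S)
             (sum-zero _ (λ t → lmulProd-annihilates k u t (z t d x) S)))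

  module QuotientByPrefix {k} (w : Fin k → E₁) (u : ℕ → E₁) (u≡w : ∀ t → u (toℕ t) ≡ w t) where

    combination-dual : ∀ j′ (z : Fin k → Φ) d x S →
      combination u z d x S ≈ sumFin D {ℤ.suc j′} (λ t → actV D (w t) j′ (z t)) d x S
    combination-dual j′ z d x S = sym (trans (reflexive (sumFin-dual (λ t → actV D (w t) j′ (z t)) d x S))
      (sum-cong-≋ (λ t → reflexive (≡.trans (actV-dual (w t) j′ (z t) d x S)
                                             (≡.cong (λ u′ → lmul u′ (z t d x) S) (≡.sym (u≡w t)))))))

    quot-≈⇒InIdeal : ∀ {j φ ψ} → GData._≈_ (quot D w) {j} φ ψ → InIdeal k u j (φ −Φ ψ)
    quot-≈⇒InIdeal (j′ , eq , z , hz , lift φ−ψ≈) = combination-of j′ eq z hz λ d x S →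
      trans (φ−ψ≈ d x _ S)
        (trans (reflexive (≡.cong (λ χ → χ d x S) (subst-dual eq (sumFin D (λ t → actV D (w t) j′ (z t))))))
               (sym (combination-dual j′ z d x S)))

    InIdeal⇒quot-≈ : ∀ {j φ ψ} → InIdeal k u j (φ −Φ ψ) → GData._≈_ (quot D w) {j} φ ψ
    InIdeal⇒quot-≈ (combination-of j′ eq z hz φ−ψ≈) = j′ , eq , z , hz , lift λ d x _ S →
      trans (φ−ψ≈ d x S)
        (trans (combination-dual j′ z d x S)
               (reflexive (≡.sym (≡.cong (λ χ → χ d x S) (subst-dual eq (sumFin D (λ t → actV D (w t) j′ (z t))))))))

  -- The half 0 :_{N*} u_k ⊆ u_k N* (modulo (u₀,…,u_{k-1})N*) of regularity.
  RegularModulo : ℕ → (ℕ → E₁) → Set (c ⊔ ℓ ⊔ m ⊔ ℓm)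
  RegularModulo k u = ∀ j φ → IsHom N j φ → InIdeal k u (ℤ.suc j) (lmulΦ (u k) φ) →
    Σ ℤ λ j′ → ℤ.suc j′ ≡ j × Σ Φ λ y → IsHom N j′ y × InIdeal k u j (φ −Φ lmulΦ (u k) y)

  module RegularSequence (u : ℕ → E₁) where

    lmulProd≈0⇒InIdeal : ∀ k → (∀ t → t ℕ.< k → RegularModulo t u) →
      ∀ {j φ} → IsHom N j φ → lmulProdΦ k u φ ≈Φ 0Φ → InIdeal k u j φ
    lmulProd≈0⇒InIdeal zero    reg {j} hφ φ≈0 = InIdeal-zero u j φ≈0
    lmulProd≈0⇒InIdeal (suc k) reg {j} {φ} hφ Pφ≈0 =
      let j′ , eq , y , hy , φ−uy∈I = reg k (ℕ.n<1+n k) j φ hφ ukφ∈I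
      in InIdeal-resp (λ d x S → sym ([x+-1*y]+y≈x (φ d x S) _)) (InIdeal-snoc φ−uy∈I hy eq)
      where
      ukφ∈I : InIdeal k u (ℤ.suc j) (lmulΦ (u k) φ)
      ukφ∈I = lmulProd≈0⇒InIdeal k (λ t t<k → reg t (ℕ.m<n⇒m<1+n t<k)) (Hom-lmul (u k) hφ)
                (λ d x S → trans (sym (lmulProd-snoc k u (φ d x) S)) (Pφ≈0 d x S))

    annihilated⇒divisible : ∀ k → (∀ t → t ℕ.< k → RegularModulo t u) →
      ∀ {j φ} → IsHom N j φ → (∀ t → t ℕ.< k → lmulΦ (u t) φ ≈Φ 0Φ) →
      Σ ℤ λ j′ → sucⁿ k j′ ≡ j × Σ Φ λ ψ → IsHom N j′ ψ × φ ≈Φ lmulProdΦ k u ψ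
    annihilated⇒divisible zero    reg {j} {φ} hφ uφ≈0 = j , ≡.refl , φ , hφ , λ d x S → refl
    annihilated⇒divisible (suc k) reg {j} {φ} hφ uφ≈0 =
      let j′ , eq , ψ , hψ , φ≈Pψ = annihilated⇒divisible k reg′ hφ (λ t t<k → uφ≈0 t (ℕ.m<n⇒m<1+n t<k))
          ukψ∈I = lmulProd≈0⇒InIdeal k reg′ (Hom-lmul (u k) hψ) (Pukψ≈0 ψ φ≈Pψ)
          j″ , eq′ , η , hη , ψ−uη∈I = reg k (ℕ.n<1+n k) j′ ψ hψ ukψ∈I
      in j″ , ≡.trans (≡.sym (sucⁿ-suc k j″)) (≡.trans (≡.cong (sucⁿ k) eq′) eq) , η , hη ,
         λ d x S → trans (φ≈Pψ d x S) (Pψ≈Puη ψ η ψ−uη∈I d x S)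
      where
      reg′ : ∀ t → t ℕ.< k → RegularModulo t u
      reg′ t t<k = reg t (ℕ.m<n⇒m<1+n t<k)

      sucⁿ-suc : ∀ k d → sucⁿ k (ℤ.suc d) ≡ ℤ.suc (sucⁿ k d)
      sucⁿ-suc zero    d = ≡.refl
      sucⁿ-suc (suc k) d = ≡.cong ℤ.suc (sucⁿ-suc k d)

      Pukψ≈0 : ∀ ψ → φ ≈Φ lmulProdΦ k u ψ → lmulProdΦ k u (lmulΦ (u k) ψ) ≈Φ 0Φ
      Pukψ≈0 ψ φ≈Pψ d x S = trans (lmulProd-sign k u (u k) (ψ d x) S)
        (negPow-zero k (trans (Lmul.cong (u k) (λ T → sym (φ≈Pψ d x T)) S) (uφ≈0 k (ℕ.n<1+n k) d x S)))

      Pψ≈Puη : ∀ {j} ψ η → InIdeal k u j (ψ −Φ lmulΦ (u k) η) → lmulProdΦ k u ψ ≈Φ lmulProdΦ (suc k) u η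
      Pψ≈Puη ψ η ψ−uη∈I d x S = begin
        lmulProd k u (ψ d x) S
          ≈⟨ LmulProd.cong k u (λ T → sym ([x+-1*y]+y≈x (ψ d x T) (lmul (u k) (η d x) T))) S ⟩
        lmulProd k u ((ψ −Φ lmulΦ (u k) η) d x +E lmul (u k) (η d x)) S
          ≈⟨ LmulProd.+-homo k u ((ψ −Φ lmulΦ (u k) η) d x) (lmul (u k) (η d x)) S ⟩
        lmulProd k u ((ψ −Φ lmulΦ (u k) η) d x) S + lmulProd k u (lmul (u k) (η d x)) S
          ≈⟨ +-congʳ (InIdeal⇒lmulProd≈0 ψ−uη∈I d x S) ⟩
        0# + lmulProd k u (lmul (u k) (η d x)) S
          ≈⟨ +-identityˡ _ ⟩
        lmulProd k u (lmul (u k) (η d x)) S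
          ≈⟨ lmulProd-snoc k u (η d x) S ⟨
        lmulProd (suc k) u (η d x) S ∎

module DualOfQuotient {c ℓ m ℓm} (K : Field c ℓ) (n : ℕ) (M : Exterior.GradedModule K n m ℓm)
  {s} (v : Fin s → Exterior.E₁ K n) where
  open Field K hiding (zero)
  open Scalars K
  open Signs K n
  open Exterior K n
  open LinearMaps K n
  open ExteriorLaws K n
  open GradedModuleLemmas K n M
  open Duality K n M
  open import Relation.Binary.Reasoning.Setoid setoid

  -- Indexing by ℕ makes the prefixes of v easy to handle; the values past s are never used.
  u : ℕ → E₁
  u = extend v (λ _ → 0#)

  Q : GData m (m ⊔ ℓm)
  Q = quot N v

  regularModulo : (∀ i → Regular (quot D (λ (t : Fin.Fin′ i) → v (Fin.inject t))) (v i)) →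
                  ∀ t → t ℕ.< s → RegularModulo t u
  regularModulo regular t t<s = ≡.subst (λ k → RegularModulo k u) (Fin.toℕ-fromℕ< t<s) (regularAt (Fin.fromℕ< t<s))
    where
    regularAt : ∀ i → RegularModulo (toℕ i) u
    regularAt i j φ hφ uφ∈I =
      let j′ , eq , y , lift hy , φ≈vy = proj₁ (regular i j φ (lift hφ)) (InIdeal⇒quot-≈ (InIdeal-resp vφ≈uφ uφ∈I))
      in j′ , eq , y , hy , InIdeal-resp (φ−uy≈ {j′} eq y) (quot-≈⇒InIdeal φ≈vy)
      where
      w = λ (t : Fin.Fin′ i) → v (Fin.inject t)
      open QuotientByPrefix w u (λ t → ≡.trans (≡.cong u (≡.sym (Fin.toℕ-inject t))) (extend-toℕ v _ (Fin.inject t)))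
      ui≡vi : u (toℕ i) ≡ v i
      ui≡vi = extend-toℕ v _ i
      vφ≈uφ : (actV (quot D w) (v i) j φ −Φ 0Φ) ≈Φ lmulΦ (u (toℕ i)) φ
      vφ≈uφ d x S = trans (+-congˡ (zeroʳ (- 1#))) (trans (+-identityʳ _)
        (reflexive (≡.trans (actV-quot-dual w (v i) j φ d x S) (≡.cong (λ u′ → lmul u′ (φ d x) S) (≡.sym ui≡vi)))))
      φ−uy≈ : ∀ {j′} (eq : ℤ.suc j′ ≡ j) y →
              (φ −Φ lmulΦ (u (toℕ i)) y) ≈Φ (φ −Φ ≡.subst (GData.C D) eq (actV (quot D w) (v i) j′ y))
      φ−uy≈ {j′} eq y d x S = +-congˡ (*-congˡ (reflexive (≡.trans (≡.cong (λ u′ → lmul u′ (y d x) S) ui≡vi)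
        (≡.sym (≡.trans (≡.cong (λ χ → χ d x S) (subst-dual eq (actV (quot D w) (v i) j′ y)))
                        (actV-quot-dual w (v i) j′ y d x S))))))

  ≈ᴹ⇒quot-≈ : ∀ d {x y} → Mod._≈ᴹ_ d x y → GData._≈_ Q {d} x y
  ≈ᴹ⇒quot-≈ d x≈y = ℤ.pred d , ℤ.suc-pred d , (λ _ → Mod.0ᴹ (ℤ.pred d)) , _ ,
    Mod.≈ᴹ-trans d (−g-≈0 d x≈y) (Mod.≈ᴹ-sym d (subst-zero (ℤ.suc-pred d)
      (sumFin-zero (ℤ.suc (ℤ.pred d)) _ (λ t → actV-zero (v t) (ℤ.pred d)))))

  actV-quot-≈0 : ∀ i d x → GData._≈_ Q {ℤ.suc d} (actV N (v i) d x) (Mod.0ᴹ (ℤ.suc d))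
  actV-quot-≈0 i d x = d , ≡.refl , single i x , _ ,
    Mod.≈ᴹ-trans (ℤ.suc d) (−g-0 (ℤ.suc d) _) (Mod.≈ᴹ-sym (ℤ.suc d) (sumFin-actV-single v i d x))

  hom-quot⇒hom : ∀ {j φ} → IsHom Q j φ → IsHom N j φ
  hom-quot⇒hom hφ = record
    { cong  = λ d x y _ _ x≈y → φ.cong d x y _ _ (≈ᴹ⇒quot-≈ d x≈y)
    ; hom-+ = λ d x y _ _ → φ.hom-+ d x y _ _
    ; hom-· = λ d r x _ → φ.hom-· d r x _
    ; homog = λ d x _ → φ.homog d x _
    ; hom-e = λ i d x _ → φ.hom-e i d x _
    }
    where module φ = IsHom hφ

  hom-quot⇒annihilated : ∀ {j φ} → IsHom Q j φ → ∀ i → lmulΦ (v i) φ ≈Φ 0Φ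
  hom-quot⇒annihilated {j} {φ} hφ i d x S = negPow≈0⇒≈0 ℤ.∣ j ∣ (begin
    sgn j (lmul (v i) (φ d x) S)                ≈⟨ hom-actV (hom-quot⇒hom hφ) (v i) d x S ⟨
    φ (ℤ.suc d) (actV N (v i) d x) S            ≈⟨ IsHom.cong hφ (ℤ.suc d) _ _ _ _ (actV-quot-≈0 i d x) S ⟩
    φ (ℤ.suc d) (Mod.0ᴹ (ℤ.suc d)) S            ≈⟨ hom-0ᴹ (hom-quot⇒hom hφ) (ℤ.suc d) S ⟩
    0#                                          ∎)

  annihilated⇒hom-quot : ∀ {j φ} → IsHom N j φ → (∀ i → lmulΦ (v i) φ ≈Φ 0Φ) → IsHom Q j φ
  annihilated⇒hom-quot {j} {φ} hφ vφ≈0 = record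
    { cong  = λ d x y _ _ x≈y → respects-quot d x y x≈y
    ; hom-+ = λ d x y _ _ → φ.hom-+ d x y _ _
    ; hom-· = λ d r x _ → φ.hom-· d r x _
    ; homog = λ d x _ → φ.homog d x _
    ; hom-e = λ i d x _ → φ.hom-e i d x _
    }
    where
    module φ = IsHom hφ
    kills-vN : ∀ d (z : Fin s → GData.C N d) → φ (ℤ.suc d) (sumFin N (λ t → actV N (v t) d (z t))) ≈E 0E
    kills-vN d z S = trans (hom-sumFin hφ (λ t → actV N (v t) d (z t)) S)
      (sum-zero _ (λ t → trans (hom-actV hφ (v t) d (z t) S) (negPow-zero ℤ.∣ j ∣ (vφ≈0 t d (z t) S))))
    kills-subst : ∀ {d′ d} (eq : ℤ.suc d′ ≡ d) w → φ (ℤ.suc d′) w ≈E 0E → φ d (≡.subst (GData.C N) eq w) ≈E 0E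
    kills-subst ≡.refl w φw≈0 = φw≈0
    respects-quot : ∀ d x y → GData._≈_ Q {d} x y → φ d x ≈E φ d y
    respects-quot d x y (d′ , eq , z , _ , x−y≈vz) S = begin
      φ d x S                                ≈⟨ φ.cong d _ _ _ _ (Mod.≈ᴹ-sym d (−g-+-cancel d x y)) S ⟩
      φ d (Mod._+ᴹ_ d (_−g_ N x y) y) S      ≈⟨ φ.hom-+ d _ _ _ _ S ⟩
      φ d (_−g_ N x y) S + φ d y S
        ≈⟨ +-congʳ (trans (φ.cong d _ _ _ _ x−y≈vz S) (kills-subst {d′} eq _ (kills-vN d′ z) S)) ⟩
      0# + φ d y S                           ≈⟨ +-identityˡ _ ⟩
      φ d y S                                ∎

  divisible⇒annihilated : ∀ {φ ψ} → φ ≈Φ lmulProdΦ s u ψ → ∀ i → lmulΦ (v i) φ ≈Φ 0Φ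
  divisible⇒annihilated {φ} {ψ} φ≈Pψ i d x S = begin
    lmul (v i) (φ d x) S                   ≈⟨ Lmul.cong (v i) (φ≈Pψ d x) S ⟩
    lmul (v i) (lmulProd s u (ψ d x)) S    ≡⟨ ≡.cong (λ u′ → lmul u′ (lmulProd s u (ψ d x)) S) (extend-toℕ v _ i) ⟨
    lmul (u (toℕ i)) (lmulProd s u (ψ d x)) S ≈⟨ lmul-lmulProd-annihilates s u i (ψ d x) S ⟩
    0#                                     ∎

  dual-quot≅image : (∀ i → Regular (quot D (λ (t : Fin.Fin′ i) → v (Fin.inject t))) (v i)) → dual Q ≅ image D v
  dual-quot≅image regular = record
    { to        = λ _ φ → φ
    ; from      = λ _ φ → φ
    ; to-In     = hom-quot⇒image
    ; from-In   = image⇒hom-quot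
    ; to-cong   = λ _ _ _ _ _ φ≈ψ → lift (lift λ d x _ → lower φ≈ψ d x _)
    ; from-cong = λ _ _ _ _ _ φ≈ψ → lift λ d x _ → lower (lower φ≈ψ) d x _
    ; to-from   = λ _ _ _ → lift (lift λ _ _ _ _ → refl)
    ; from-to   = λ _ _ _ → lift λ _ _ _ _ → refl
    ; to-+      = λ _ _ _ _ _ → lift (lift λ _ _ _ _ → refl)
    ; to-·      = λ _ _ _ _ → lift (lift λ _ _ _ _ → refl)
    ; to-act    = λ _ _ _ _ → lift (lift λ _ _ _ _ → refl)
    }
    where
    actProd≈lmulProd : ∀ {j j′} (eq : sucⁿ s j′ ≡ j) ψ → ≡.subst (GData.C D) eq (actProd D v j′ ψ) ≈Φ lmulProdΦ s u ψ
    actProd≈lmulProd {j′ = j′} eq ψ d x S =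
      trans (reflexive (≡.cong (λ χ → χ d x S) (subst-dual eq (actProd D v j′ ψ))))
            (actProd-dual v u (extend-toℕ v _) j′ ψ d x S)

    hom-quot⇒image : ∀ j φ → IsHom Q j φ → GData.In (image D v) j φ
    hom-quot⇒image j φ hφ =
      let j′ , eq , ψ , hψ , φ≈Pψ = RegularSequence.annihilated⇒divisible u s (regularModulo regular) (hom-quot⇒hom hφ)
                                       (λ t t<s → uφ≈0 t t<s)
      in hom-quot⇒hom hφ , j′ , eq , ψ , hψ , lift λ d x _ S → trans (φ≈Pψ d x S) (sym (actProd≈lmulProd eq ψ d x S))
      where
      uφ≈0 : ∀ t → t ℕ.< s → lmulΦ (u t) φ ≈Φ 0Φ
      uφ≈0 t t<s d x S = trans
        (reflexive (≡.cong (λ u′ → lmul u′ (φ d x) S)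
          (≡.trans (≡.cong u (≡.sym (Fin.toℕ-fromℕ< t<s))) (extend-toℕ v _ (Fin.fromℕ< t<s)))))
        (hom-quot⇒annihilated hφ (Fin.fromℕ< t<s) d x S)

    image⇒hom-quot : ∀ j φ → GData.In (image D v) j φ → IsHom Q j φ
    image⇒hom-quot j φ (hφ , j′ , eq , ψ , _ , lift φ≈) =
      annihilated⇒hom-quot hφ (divisible⇒annihilated λ d x S → trans (φ≈ d x _ S) (actProd≈lmulProd eq ψ d x S))

corollary4p4 : ∀ {c ℓ m ℓm} (K : Field c ℓ) (n : ℕ)
    (M : Exterior.GradedModule K n m ℓm) →
    Exterior.GradedModule.FinitelyGenerated M →
    ∀ {s : ℕ} (v : Fin s → Exterior.E₁ K n) →
    Exterior.RegularSeq K n (Exterior.dual K n (Exterior.GradedModule.data′ M)) v →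
    Exterior._≅_ K n
      (Exterior.dual K n (Exterior.quot K n (Exterior.GradedModule.data′ M) v))
      (Exterior.image K n (Exterior.dual K n (Exterior.GradedModule.data′ M)) v)
corollary4p4 K n M _ v (regular , _) = DualOfQuotient.dual-quot≅image K n M v regular
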